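{- For every $n\in\mathbb{Z}^+$ and every set $S$ of positive integers, there is a bijection between $\mathrm{FR}^{\mathrm{T1}}_{n,S}$ and $\mathrm{UPF}^{\mathrm{T1}}_{n,S}$.
   Context: A parking preference $(a_1,\dots,a_n)\in[n]^n$ describes $n$ cars entering a one-way street with spots $1,\dots,n$ in the order $1,2,\dots,n$; car $i$ parks in the first unoccupied spot numbered $\ge a_i$. It is a parking function if all cars park. It is a unit interval parking function (UPF) if it is a parking function and every car $i$ parks in spot $a_i$ or spot $a_i+1$. Car $i$ is lucky if it parks in spot $a_i$. $\mathrm{UPF}^{\mathrm{T1}}_{n,S}$ is the set of unit interval parking functions of length $n$ whose number of lucky cars belongs to $S$. A Fubini ranking of length $n$ is a tuple $(b_1,\dots,b_n)\in[n]^n$ that satisfies two conditions. First, some $b_i$ equals $1$. Second, for every value $x$ occurring exactly $k>0$ times, the next larger value occurring in the tuple (if there is one) is $x+k$. The distinct values occurring are its ranks. $\mathrm{FR}^{\mathrm{T1}}_{n,S}$ is the set of Fubini rankings of length $n$ whose number of distinct ranks belongs to $S$. -}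

module Defs where

open import Data.Nat using (ℕ; zero; suc; _+_; _≤_; _<_; _≟_; _≤?_; _<?_)
open import Data.Fin using (Fin)
open import Data.Vec using (Vec; []; _∷_; lookup; count; toList)
open import Data.List using (List; []; _∷_; length; upTo; filter; map)
open import Data.Bool.ListAction using (all; any)
open import Data.Vec.Relation.Unary.All using () renaming (All to VAll)
open import Data.List.Membership.Propositional using (_∈_)
open import Data.Maybe using (Maybe; just; nothing)
open import Data.Product using (Σ; ∃; _×_; _,_)
open import Data.Bool using (Bool; true; false; if_then_else_; T; _∧_; _∨_; not)
open import Relation.Nullary using (¬_; Dec; yes; no)
open import Relation.Nullary.Decidable using (⌊_⌋)
open import Relation.Binary.PropositionalEquality using (_≡_)

occupied : ℕ → List ℕ → Bool
occupied x [] = false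
occupied x (y ∷ ys) = if ⌊ x ≟ y ⌋ then true else occupied x ys

firstFree : (n : ℕ) → (a : ℕ) → (fuel : ℕ) → List ℕ → Maybe ℕ
firstFree n a zero occ = nothing
firstFree n a (suc fuel) occ with a ≤? n
... | no _ = nothing
... | yes _ = if occupied a occ then firstFree n (suc a) fuel occ else just a

-- cars enter in order 1..k; returns the spots they park in, or nothing
-- if some car fails to park (street has spots 1..n).
parkFrom : (n : ℕ) → List ℕ → {k : ℕ} → Vec ℕ k → Maybe (Vec ℕ k)
parkFrom n occ [] = just []
parkFrom n occ (a ∷ as) with firstFree n a (suc n) occ
... | nothing = nothing
... | just s with parkFrom n (s ∷ occ) as
...   | nothing = nothing
...   | just ss = just (s ∷ ss)

parking : {n : ℕ} → Vec ℕ n → Maybe (Vec ℕ n)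
parking {n} a = parkFrom n [] a

-- a ∈ [n]^n
-- (stated with the inductive `All` so that proofs are propositional without funext)
InRange : {n : ℕ} → Vec ℕ n → Set
InRange {n} a = VAll (λ x → 1 ≤ x × x ≤ n) a

Outcome : {n : ℕ} → Vec ℕ n → Vec ℕ n → Set
Outcome a p = parking a ≡ just p

IsParkingFunction : {n : ℕ} → Vec ℕ n → Set
IsParkingFunction a = InRange a × ∃ λ p → Outcome a p

unitInterval : {n : ℕ} → Vec ℕ n → Vec ℕ n → Bool
unitInterval [] [] = true
unitInterval (a ∷ as) (p ∷ ps) = (⌊ p ≟ a ⌋ ∨ ⌊ p ≟ suc a ⌋) ∧ unitInterval as ps

IsUPFWith : {n : ℕ} → Vec ℕ n → Vec ℕ n → Set
IsUPFWith {n} a p = InRange a × Outcome a p ×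
  T (unitInterval a p)

luckyCount : {n : ℕ} → Vec ℕ n → Vec ℕ n → ℕ
luckyCount [] [] = 0
luckyCount (a ∷ as) (p ∷ ps) with a ≟ p
... | yes _ = suc (luckyCount as ps)
... | no  _ = luckyCount as ps

UPF-T1 : (n : ℕ) → (S : ℕ → Set) → Set
UPF-T1 n S = Σ (Vec ℕ n) λ a → Σ (Vec ℕ n) λ p → IsUPFWith a p × S (luckyCount a p)

occ : {n : ℕ} → ℕ → Vec ℕ n → ℕ
occ x b = count (λ y → y ≟ x) b

Occurs : {n : ℕ} → ℕ → Vec ℕ n → Set
Occurs x b = 0 < occ x b

vals : ℕ → List ℕ
vals n = map suc (upTo n)

-- for all occurring x, y in 1..n with x < y and no occurring z strictly between,
-- y = x + occ x b.  (All values of b lie in 1..n, so bounded quantification is exact.)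
nextRankOK : {n : ℕ} → Vec ℕ n → Bool
nextRankOK {n} b = all (λ x → all (λ y → implies x y) (vals n)) (vals n)
  where
    oc : ℕ → Bool
    oc x = ⌊ 0 <? occ x b ⌋
    between : ℕ → ℕ → Bool
    between x y = any (λ z → oc z ∧ ⌊ x <? z ⌋ ∧ ⌊ z <? y ⌋) (vals n)
    implies : ℕ → ℕ → Bool
    implies x y = not (oc x ∧ oc y ∧ ⌊ x <? y ⌋ ∧ not (between x y)) ∨ ⌊ y ≟ x + occ x b ⌋

IsFubiniRanking : {n : ℕ} → Vec ℕ n → Set
IsFubiniRanking {n} b = InRange b × Occurs 1 b × T (nextRankOK b)

-- number of distinct values (ranks) occurring in b (all values lie in 1..n)
numRanks : {n : ℕ} → Vec ℕ n → ℕ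
numRanks {n} b = length (filter (λ x → 0 <? occ x b) (upTo (suc n)))

FR-T1 : (n : ℕ) → (S : ℕ → Set) → Set
FR-T1 n S = Σ (Vec ℕ n) λ b → IsFubiniRanking b × S (numRanks b)

-- A Fubini ranking is the same thing as a standard competition ranking: every entry is one more
-- than the number of strictly smaller entries.  Hence the cars of rank x can be given the block
-- of spots x, x + 1, …, x + #x − 1, and these blocks tile 1, …, n.  The (c+1)-th car of rank x is
-- sent to the preference x + c − 1 (to x when c = 0), so it parks at x + c: exactly the first car
-- of each rank is lucky, and the number of lucky cars is the number of ranks.  Conversely, in a
-- unit interval parking function a lucky car opens a new rank at its spot and an unlucky car,
-- parking just behind the car in spot a_i, inherits that car's rank.  The final occupancy is again
-- a tiling by rank blocks, which makes the recovered ranks a competition ranking, and the two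
-- constructions undo each other.

module Submission where

open import Axiom.UniquenessOfIdentityProofs.WithK using (uip)
open import Data.Bool using (Bool; true; false; T; not; _∧_; _∨_; if_then_else_)
open import Data.Bool.ListAction using (all; any)
open import Data.Bool.Properties using (T-≡; T-∧; T-∨; T-irrelevant; ∧-identityʳ; ∧-zeroʳ)
open import Data.Empty using (⊥; ⊥-elim)
open import Data.List using (List; []; _∷_; length; map; filter; upTo; _++_)
open import Data.List.Extrema.Nat using (min; argmin-sel; min≤⊤; min≤xs; max; argmax-sel; xs≤max; max<v⁺)
open import Data.List.Membership.Propositional using (_∈_; find; lose)
open import Data.List.Membership.Propositional.Properties
  using (∈-map⁺; ∈-map⁻; ∈-upTo⁺; ∈-filter⁺; ∈-filter⁻)
open import Data.List.Properties using (length-map; ++-identityʳ; upTo-∷ʳ)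
import Data.List.Relation.Unary.All as ListAll
open import Data.List.Relation.Unary.All.Properties using (all⁺; all⁻; all-filter)
open import Data.List.Relation.Unary.Any using (here; there)
open import Data.List.Relation.Unary.Any.Properties using (any⁺; any⁻)
open import Data.Maybe using (Maybe; just; nothing)
open import Data.Maybe.Properties using (just-injective)
open import Data.Nat using (ℕ; zero; suc; pred; _+_; _∸_; _≤_; _<_; z≤n; s≤s; _≟_; _≤?_; _<?_)
open import Data.Nat.Induction using (<-rec)
open import Data.Nat.Properties
open import Algebra.Properties.CommutativeSemigroup +-commutativeSemigroup
  using (interchange; x∙yz≈y∙xz; xy∙z≈y∙xz; x∙yz≈yx∙z)
open import Data.Product using (∃; _×_; _,_; proj₁; proj₂)
open import Data.Sum using (_⊎_; inj₁; inj₂)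
open import Data.Vec using (Vec; []; _∷_; toList)
open import Data.Vec.Properties using (length-toList)
open import Data.Vec.Relation.Unary.All using ([]; _∷_) renaming (All to VAll)
import Data.Vec.Relation.Unary.All as VecAll
open import Data.Vec.Relation.Unary.All.Properties using (toList⁺; toList⁻)
open import Function using (_∘′_; id)
open import Function.Bundles using (Equivalence; _↔_; mk↔ₛ′)
open import Relation.Binary.Definitions using (tri<; tri≈; tri>)
open import Relation.Binary.PropositionalEquality
  using (_≡_; _≢_; refl; sym; trans; cong; cong₂; subst; module ≡-Reasoning)
open import Relation.Nullary using (¬_; Dec; yes; no; does; contradiction)
open import Relation.Nullary.Decidable using (⌊_⌋; isYes≗does; dec-true; dec-false; toWitness; fromWitness)

open import Defs

module _ {P : Set} where

  ⌊⌋-true : (P? : Dec P) → P → ⌊ P? ⌋ ≡ true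
  ⌊⌋-true P? p = trans (isYes≗does P?) (dec-true P? p)

  ⌊⌋-false : (P? : Dec P) → ¬ P → ⌊ P? ⌋ ≡ false
  ⌊⌋-false P? ¬p = trans (isYes≗does P?) (dec-false P? ¬p)

  ⌊⌋-true⁻ : (P? : Dec P) → ⌊ P? ⌋ ≡ true → P
  ⌊⌋-true⁻ P? e = toWitness (Equivalence.from T-≡ e)

bit : Bool → ℕ
bit true = 1
bit false = 0

countᵇ : {A : Set} → (A → Bool) → List A → ℕ
countᵇ p [] = 0
countᵇ p (x ∷ xs) = bit (p x) + countᵇ p xs

module _ {A : Set} where

  countᵇ-cong : (p q : A → Bool) (xs : List A) → (∀ {x} → x ∈ xs → p x ≡ q x) →
    countᵇ p xs ≡ countᵇ q xs
  countᵇ-cong p q [] h = refl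
  countᵇ-cong p q (x ∷ xs) h = cong₂ _+_ (cong bit (h (here refl))) (countᵇ-cong p q xs (h ∘′ there))

  countᵇ≡0 : (p : A → Bool) (xs : List A) → (∀ {x} → x ∈ xs → p x ≡ false) → countᵇ p xs ≡ 0
  countᵇ≡0 p [] h = refl
  countᵇ≡0 p (x ∷ xs) h rewrite h (here refl) = countᵇ≡0 p xs (h ∘′ there)

  countᵇ>0 : (p : A → Bool) (xs : List A) {x : A} → x ∈ xs → p x ≡ true → 0 < countᵇ p xs
  countᵇ>0 p (y ∷ xs) (here refl) px rewrite px = s≤s z≤n
  countᵇ>0 p (y ∷ xs) (there x∈xs) px = ≤-trans (countᵇ>0 p xs x∈xs px) (m≤n+m _ (bit (p y)))

  countᵇ>0⁻ : (p : A → Bool) (xs : List A) → 0 < countᵇ p xs → ∃ λ x → x ∈ xs × p x ≡ true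
  countᵇ>0⁻ p (y ∷ xs) pos with p y in py
  ... | true = y , here refl , py
  ... | false with countᵇ>0⁻ p xs pos
  ...   | x , x∈xs , px = x , there x∈xs , px

  countᵇ-split : (r p q : A → Bool) (xs : List A) →
    (∀ {x} → x ∈ xs → bit (r x) ≡ bit (p x) + bit (q x)) →
    countᵇ r xs ≡ countᵇ p xs + countᵇ q xs
  countᵇ-split r p q [] h = refl
  countᵇ-split r p q (x ∷ xs) h
    rewrite h (here refl) | countᵇ-split r p q xs (h ∘′ there) =
    interchange (bit (p x)) (bit (q x)) (countᵇ p xs) (countᵇ q xs)

  countᵇ-mono : (p q : A → Bool) (xs : List A) → (∀ {x} → x ∈ xs → p x ≡ true → q x ≡ true) →
    countᵇ p xs ≤ countᵇ q xs
  countᵇ-mono p q [] h = z≤n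
  countᵇ-mono p q (x ∷ xs) h = +-mono-≤ (bit-mono (h (here refl))) (countᵇ-mono p q xs (h ∘′ there))
    where
    bit-mono : ∀ {a b} → (a ≡ true → b ≡ true) → bit a ≤ bit b
    bit-mono {false} _ = z≤n
    bit-mono {true} a⇒b rewrite a⇒b refl = ≤-refl

  countᵇ+countᵇ-not : (p : A → Bool) (xs : List A) → countᵇ p xs + countᵇ (not ∘′ p) xs ≡ length xs
  countᵇ+countᵇ-not p [] = refl
  countᵇ+countᵇ-not p (x ∷ xs) with p x
  ... | true = cong suc (countᵇ+countᵇ-not p xs)
  ... | false = trans (+-suc _ _) (cong suc (countᵇ+countᵇ-not p xs))

  countᵇ≤length : (p : A → Bool) (xs : List A) → countᵇ p xs ≤ length xs
  countᵇ≤length p xs = ≤-trans (m≤m+n _ _) (≤-reflexive (countᵇ+countᵇ-not p xs))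

  countᵇ-++ : (p : A → Bool) (xs ys : List A) → countᵇ p (xs ++ ys) ≡ countᵇ p xs + countᵇ p ys
  countᵇ-++ p [] ys = refl
  countᵇ-++ p (x ∷ xs) ys = trans (cong (bit (p x) +_) (countᵇ-++ p xs ys)) (sym (+-assoc (bit (p x)) _ _))

countᵇ-map : {A B : Set} (p : B → Bool) (f : A → B) (xs : List A) → countᵇ p (map f xs) ≡ countᵇ (p ∘′ f) xs
countᵇ-map p f [] = refl
countᵇ-map p f (x ∷ xs) = cong (bit (p (f x)) +_) (countᵇ-map p f xs)

length-filter≡countᵇ : {A : Set} {P : A → Set} (P? : ∀ x → Dec (P x)) (xs : List A) →
  length (filter P? xs) ≡ countᵇ (λ x → ⌊ P? x ⌋) xs
length-filter≡countᵇ P? [] = refl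
length-filter≡countᵇ P? (x ∷ xs) with P? x
... | yes _ = cong suc (length-filter≡countᵇ P? xs)
... | no _ = length-filter≡countᵇ P? xs

multiplicity : ℕ → List ℕ → ℕ
multiplicity v = countᵇ (λ x → ⌊ x ≟ v ⌋)

countBelow : ℕ → List ℕ → ℕ
countBelow v = countᵇ (λ x → ⌊ x <? v ⌋)

multiplicity>0 : ∀ {v xs} → v ∈ xs → 0 < multiplicity v xs
multiplicity>0 {v} {xs} v∈xs = countᵇ>0 _ xs v∈xs (⌊⌋-true (v ≟ v) refl)

multiplicity>0⁻ : ∀ {v xs} → 0 < multiplicity v xs → v ∈ xs
multiplicity>0⁻ {v} {xs} pos with countᵇ>0⁻ _ xs pos
... | x , x∈xs , x≟v with x ≟ v | x≟v
...   | yes refl | _ = x∈xs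
...   | no _ | ()

multiplicity-here : ∀ x xs → multiplicity x (x ∷ xs) ≡ suc (multiplicity x xs)
multiplicity-here x xs rewrite ⌊⌋-true (x ≟ x) refl = refl

multiplicity-there : ∀ {x y} xs → y ≢ x → multiplicity x (y ∷ xs) ≡ multiplicity x xs
multiplicity-there {x} {y} xs y≢x rewrite ⌊⌋-false (y ≟ x) y≢x = refl

multiplicity-∷ : ∀ v y xs → multiplicity v xs ≤ multiplicity v (y ∷ xs)
multiplicity-∷ v y xs = m≤n+m _ (bit ⌊ y ≟ v ⌋)

occ≡multiplicity : ∀ {n} x (b : Vec ℕ n) → occ x b ≡ multiplicity x (toList b)
occ≡multiplicity x [] = refl
occ≡multiplicity x (y ∷ b) = trans (count-step (y ≟ x) _) (cong (bit ⌊ y ≟ x ⌋ +_) (occ≡multiplicity x b))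
  where
  count-step : {P : Set} (P? : Dec P) (m : ℕ) → (if does P? then suc else id) m ≡ bit ⌊ P? ⌋ + m
  count-step (yes _) m = refl
  count-step (no _) m = refl

countAtMost≡countBelow+multiplicity : ∀ v xs →
  countᵇ (λ x → ⌊ x ≤? v ⌋) xs ≡ countBelow v xs + multiplicity v xs
countAtMost≡countBelow+multiplicity v xs = countᵇ-split _ _ _ xs (λ {x} _ → pointwise x)
  where
  pointwise : ∀ x → bit ⌊ x ≤? v ⌋ ≡ bit ⌊ x <? v ⌋ + bit ⌊ x ≟ v ⌋
  pointwise x with x ≟ v
  ... | yes refl rewrite ⌊⌋-true (x ≤? x) ≤-refl | ⌊⌋-false (x <? x) (n≮n x) = refl
  ... | no x≢v with x ≤? v
  ...   | yes x≤v rewrite ⌊⌋-true (x <? v) (≤∧≢⇒< x≤v x≢v) = refl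
  ...   | no x≰v rewrite ⌊⌋-false (x <? v) (x≰v ∘′ <⇒≤) = refl

countBelow+multiplicity≤length : ∀ v xs → countBelow v xs + multiplicity v xs ≤ length xs
countBelow+multiplicity≤length v xs =
  ≤-trans (≤-reflexive (sym (countAtMost≡countBelow+multiplicity v xs))) (countᵇ≤length _ xs)

-- Competition rankings

Consecutive : List ℕ → ℕ → ℕ → Set
Consecutive xs w v = w ∈ xs × w < v × v ∈ xs × (∀ {z} → z ∈ xs → w < z → z < v → ⊥)

countBelow-consecutive : ∀ {xs w v} → Consecutive xs w v →
  countBelow v xs ≡ countBelow w xs + multiplicity w xs
countBelow-consecutive {xs} {w} {v} (_ , w<v , _ , gap) = begin
  countBelow v xs
    ≡⟨ countᵇ-split _ _ _ xs (λ {x} _ → below-v x) ⟩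
  countBelow w xs + countᵇ (λ x → ⌊ w ≤? x ⌋ ∧ ⌊ x <? v ⌋) xs
    ≡⟨ cong (countBelow w xs +_) (countᵇ-split _ _ _ xs (λ {x} _ → from-w x)) ⟩
  countBelow w xs + (multiplicity w xs + countᵇ between xs)
    ≡⟨ cong (λ k → countBelow w xs + (multiplicity w xs + k)) (countᵇ≡0 between xs no-between) ⟩
  countBelow w xs + (multiplicity w xs + 0)
    ≡⟨ cong (countBelow w xs +_) (+-identityʳ _) ⟩
  countBelow w xs + multiplicity w xs
    ∎
  where
  open ≡-Reasoning
  between : ℕ → Bool
  between x = ⌊ w <? x ⌋ ∧ ⌊ x <? v ⌋
  below-v : ∀ x → bit ⌊ x <? v ⌋ ≡ bit ⌊ x <? w ⌋ + bit (⌊ w ≤? x ⌋ ∧ ⌊ x <? v ⌋)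
  below-v x with x <? w
  ... | yes x<w rewrite ⌊⌋-true (x <? v) (<-trans x<w w<v) | ⌊⌋-false (w ≤? x) (<⇒≱ x<w) = refl
  ... | no x≮w rewrite ⌊⌋-true (w ≤? x) (≮⇒≥ x≮w) = refl
  from-w : ∀ x → bit (⌊ w ≤? x ⌋ ∧ ⌊ x <? v ⌋) ≡ bit ⌊ x ≟ w ⌋ + bit (between x)
  from-w x with x ≟ w
  ... | yes refl rewrite ⌊⌋-true (x ≤? x) ≤-refl | ⌊⌋-false (x <? x) (n≮n x) | ⌊⌋-true (x <? v) w<v = refl
  ... | no x≢w with w ≤? x
  ...   | yes w≤x rewrite ⌊⌋-true (w <? x) (≤∧≢⇒< w≤x (x≢w ∘′ sym)) = refl
  ...   | no w≰x rewrite ⌊⌋-false (w <? x) (w≰x ∘′ <⇒≤) = refl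
  no-between : ∀ {x} → x ∈ xs → between x ≡ false
  no-between {x} x∈xs with w <? x | x <? v
  ... | yes w<x | yes x<v = ⊥-elim (gap x∈xs w<x x<v)
  ... | yes _ | no _ = refl
  ... | no _ | _ = refl

predecessor : ∀ {xs u v} → u ∈ xs → u < v → v ∈ xs → ∃ λ w → Consecutive xs w v
predecessor {xs} {u} {v} u∈xs u<v v∈xs = w , w∈xs , w<v , v∈xs , gap
  where
  smaller = filter (_<? v) xs
  w = max u smaller
  w∈xs : w ∈ xs
  w∈xs with argmax-sel id u smaller
  ... | inj₁ w≡u = subst (_∈ xs) (sym w≡u) u∈xs
  ... | inj₂ w∈smaller = proj₁ (∈-filter⁻ (_<? v) w∈smaller)
  w<v : w < v
  w<v = max<v⁺ u<v (all-filter (_<? v) xs)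
  gap : ∀ {z} → z ∈ xs → w < z → z < v → ⊥
  gap z∈xs w<z z<v = <⇒≱ w<z (ListAll.lookup (xs≤max u smaller) (∈-filter⁺ (_<? v) z∈xs z<v))

IsCompetitionRanking : List ℕ → Set
IsCompetitionRanking xs = ∀ {v} → v ∈ xs → v ≡ suc (countBelow v xs)

competition-consecutive : ∀ {xs w v} → IsCompetitionRanking xs → Consecutive xs w v →
  v ≡ w + multiplicity w xs
competition-consecutive {xs} {w} {v} rank cons@(w∈xs , _ , v∈xs , _) = begin
  v                                            ≡⟨ rank v∈xs ⟩
  suc (countBelow v xs)                        ≡⟨ cong suc (countBelow-consecutive cons) ⟩
  suc (countBelow w xs) + multiplicity w xs    ≡⟨ cong (_+ multiplicity w xs) (rank w∈xs) ⟨
  w + multiplicity w xs                        ∎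
  where open ≡-Reasoning

inRange⁻ : ∀ {n} {b : Vec ℕ n} → InRange b → ∀ {x} → x ∈ toList b → 1 ≤ x × x ≤ n
inRange⁻ ir = ListAll.lookup (toList⁺ ir)

inRange⁺ : ∀ {n} {b : Vec ℕ n} → (∀ {x} → x ∈ toList b → 1 ≤ x × x ≤ n) → InRange b
inRange⁺ h = toList⁻ (ListAll.tabulate h)

∈-vals : ∀ {n x} → 1 ≤ x × x ≤ n → x ∈ vals n
∈-vals {x = suc y} (_ , x≤n) = ∈-map⁺ suc (∈-upTo⁺ x≤n)

T-guarded⁻ : ∀ a b c d e → T (not (a ∧ b ∧ c ∧ not d) ∨ e) → T a → T b → T c → ¬ T d → T e
T-guarded⁻ true true true false e t _ _ _ _ = t
T-guarded⁻ true true true true e _ _ _ _ ¬d = ⊥-elim (¬d _)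

T-guarded⁺ : ∀ a b c d e → (T a → T b → T c → ¬ T d → T e) → T (not (a ∧ b ∧ c ∧ not d) ∨ e)
T-guarded⁺ false b c d e _ = _
T-guarded⁺ true false c d e _ = _
T-guarded⁺ true true false d e _ = _
T-guarded⁺ true true true true e _ = _
T-guarded⁺ true true true false e h = h _ _ _ λ ()

module _ {n : ℕ} (b : Vec ℕ n) where
  private
    B = toList b

  occursᵇ : ℕ → Bool
  occursᵇ x = ⌊ 0 <? occ x b ⌋

  occurs⇒∈ : ∀ {x} → T (occursᵇ x) → x ∈ B
  occurs⇒∈ {x} t = multiplicity>0⁻ (subst (0 <_) (occ≡multiplicity x b) (toWitness t))

  ∈⇒occurs : ∀ {x} → x ∈ B → T (occursᵇ x)
  ∈⇒occurs {x} x∈B = fromWitness (subst (0 <_) (sym (occ≡multiplicity x b)) (multiplicity>0 x∈B))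

  occursBetweenᵇ : ℕ → ℕ → ℕ → Bool
  occursBetweenᵇ w v z = occursᵇ z ∧ ⌊ w <? z ⌋ ∧ ⌊ z <? v ⌋

  betweenᵇ : ℕ → ℕ → Bool
  betweenᵇ w v = any (occursBetweenᵇ w v) (vals n)

  occursBetween⁻ : ∀ {w v z} → T (occursBetweenᵇ w v z) → z ∈ B × w < z × z < v
  occursBetween⁻ {w} {v} {z} t with Equivalence.to (T-∧ {occursᵇ z}) t
  ... | z∈B , w<z∧z<v with Equivalence.to (T-∧ {⌊ w <? z ⌋}) w<z∧z<v
  ...   | w<z , z<v = occurs⇒∈ z∈B , toWitness {a? = w <? z} w<z , toWitness {a? = z <? v} z<v

  occursBetween⁺ : ∀ {w v z} → z ∈ B → w < z → z < v → T (occursBetweenᵇ w v z)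
  occursBetween⁺ {w} {v} {z} z∈B w<z z<v = Equivalence.from (T-∧ {occursᵇ z})
    (∈⇒occurs z∈B , Equivalence.from (T-∧ {⌊ w <? z ⌋}) (fromWitness w<z , fromWitness z<v))

  -- The local `implies` of nextRankOK, restated so that it can be named.
  rankStepᵇ : ℕ → ℕ → Bool
  rankStepᵇ w v = not (occursᵇ w ∧ occursᵇ v ∧ ⌊ w <? v ⌋ ∧ not (betweenᵇ w v)) ∨ ⌊ v ≟ w + occ w b ⌋

  nextRankOK⇒ : InRange b → T (nextRankOK b) → ∀ {w v} → Consecutive B w v → v ≡ w + occ w b
  nextRankOK⇒ ir ok {w} {v} (w∈B , w<v , v∈B , gap) =
    toWitness (T-guarded⁻ _ _ _ _ _ guarded (∈⇒occurs w∈B) (∈⇒occurs v∈B) (fromWitness w<v) no-between)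
    where
    rows = all⁺ (λ w → all (rankStepᵇ w) (vals n)) (vals n) ok
    guarded : T (rankStepᵇ w v)
    guarded = ListAll.lookup (all⁺ (rankStepᵇ w) (vals n) (ListAll.lookup rows (∈-vals (inRange⁻ ir w∈B))))
                (∈-vals (inRange⁻ ir v∈B))
    no-between : ¬ T (betweenᵇ w v)
    no-between t with find (any⁻ (occursBetweenᵇ w v) (vals n) t)
    ... | z , _ , tz with occursBetween⁻ tz
    ...   | z∈B , w<z , z<v = gap z∈B w<z z<v

  nextRankOK⇐ : InRange b → (∀ {w v} → Consecutive B w v → v ≡ w + occ w b) → T (nextRankOK b)
  nextRankOK⇐ ir h = all⁻ (λ w → all (rankStepᵇ w) (vals n)) {vals n} (ListAll.tabulate λ {w} _ →
    all⁻ (rankStepᵇ w) {vals n} (ListAll.tabulate λ {v} _ → step w v))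
    where
    step : ∀ w v → T (rankStepᵇ w v)
    step w v = T-guarded⁺ _ _ _ _ _ λ w∈B v∈B w<v ¬between →
      fromWitness (h (occurs⇒∈ w∈B , toWitness w<v , occurs⇒∈ v∈B , λ z∈B w<z z<v →
        ¬between (any⁺ (occursBetweenᵇ w v) (lose (∈-vals (inRange⁻ ir z∈B)) (occursBetween⁺ z∈B w<z z<v)))))

fubini⇒competition : ∀ {n} (b : Vec ℕ n) → IsFubiniRanking b → IsCompetitionRanking (toList b)
fubini⇒competition b (ir , one , ok) {v} = <-rec P rank v
  where
  B = toList b
  P : ℕ → Set
  P v = v ∈ B → v ≡ suc (countBelow v B)
  1∈B : 1 ∈ B
  1∈B = occurs⇒∈ b (fromWitness one)
  rank : ∀ v → (∀ {u} → u < v → P u) → P v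
  rank zero _ 0∈B with inRange⁻ ir 0∈B
  ... | () , _
  rank 1 _ _ = cong suc (sym (countᵇ≡0 _ B λ x∈B →
    ⌊⌋-false (_ <? 1) (λ x<1 → <⇒≱ x<1 (proj₁ (inRange⁻ ir x∈B)))))
  rank v@(suc (suc _)) below v∈B with predecessor 1∈B (s≤s (s≤s z≤n)) v∈B
  ... | w , cons@(w∈B , w<v , _) = begin
    v                                        ≡⟨ nextRankOK⇒ b ir ok cons ⟩
    w + occ w b                              ≡⟨ cong₂ _+_ (below w<v w∈B) (occ≡multiplicity w b) ⟩
    suc (countBelow w B) + multiplicity w B  ≡⟨ cong suc (countBelow-consecutive cons) ⟨
    suc (countBelow v B)                     ∎
    where open ≡-Reasoning

competition-bounded : ∀ {xs v} → IsCompetitionRanking xs → v ∈ xs → 1 ≤ v × v ≤ length xs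
competition-bounded {xs} {v} rank v∈xs = subst (1 ≤_) (sym (rank v∈xs)) (s≤s z≤n) , (begin
  v                                     ≡⟨ rank v∈xs ⟩
  suc (countBelow v xs)                 ≡⟨ +-comm 1 _ ⟩
  countBelow v xs + 1                   ≤⟨ +-monoʳ-≤ (countBelow v xs) (multiplicity>0 v∈xs) ⟩
  countBelow v xs + multiplicity v xs   ≤⟨ countBelow+multiplicity≤length v xs ⟩
  length xs                             ∎)
  where open ≤-Reasoning

1∈competition : ∀ {x xs} → IsCompetitionRanking (x ∷ xs) → 1 ∈ x ∷ xs
1∈competition {x} {xs} rank = subst (_∈ x ∷ xs) (trans (rank m∈) (cong suc nothing-below)) m∈
  where
  m = min x xs
  m∈ : m ∈ x ∷ xs
  m∈ with argmin-sel id x xs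
  ... | inj₁ m≡x = here m≡x
  ... | inj₂ m∈xs = there m∈xs
  m≤ : ∀ {y} → y ∈ x ∷ xs → m ≤ y
  m≤ (here refl) = min≤⊤ x xs
  m≤ (there y∈xs) = ListAll.lookup (min≤xs x xs) y∈xs
  nothing-below : countBelow m (x ∷ xs) ≡ 0
  nothing-below = countᵇ≡0 _ (x ∷ xs) λ y∈ → ⌊⌋-false (_ <? m) (λ y<m → <⇒≱ y<m (m≤ y∈))

competition⇒fubini : ∀ {n} (b : Vec ℕ n) → 1 ≤ n → IsCompetitionRanking (toList b) → IsFubiniRanking b
competition⇒fubini b@(_ ∷ _) _ rank = ir , one , nextRankOK⇐ b ir consecutive-step
  where
  B = toList b
  ir : InRange b
  ir = inRange⁺ λ {x} x∈B →
    let 1≤x , x≤length = competition-bounded rank x∈B in 1≤x , subst (x ≤_) (length-toList b) x≤length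
  one : Occurs 1 b
  one = subst (0 <_) (sym (occ≡multiplicity 1 b)) (multiplicity>0 (1∈competition rank))
  consecutive-step : ∀ {w v} → Consecutive B w v → v ≡ w + occ w b
  consecutive-step {w} cons =
    trans (competition-consecutive rank cons) (cong (w +_) (sym (occ≡multiplicity w b)))

-- Unit interval runs

∈⇒occupied : ∀ {x xs} → x ∈ xs → occupied x xs ≡ true
∈⇒occupied {x} {y ∷ xs} x∈ with x ≟ y | x∈
... | yes _ | _ = refl
... | no _ | there x∈xs = ∈⇒occupied x∈xs
... | no x≢y | here x≡y = contradiction x≡y x≢y

occupied⇒∈ : ∀ {x xs} → occupied x xs ≡ true → x ∈ xs
occupied⇒∈ {x} {y ∷ xs} h with x ≟ y
... | yes x≡y = here x≡y
... | no _ = there (occupied⇒∈ h)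

∉⇒unoccupied : ∀ {x xs} → ¬ x ∈ xs → occupied x xs ≡ false
∉⇒unoccupied {x} {xs} x∉xs with occupied x xs in h
... | true = contradiction (occupied⇒∈ h) x∉xs
... | false = refl

unoccupied⇒∉ : ∀ {x xs} → occupied x xs ≡ false → ¬ x ∈ xs
unoccupied⇒∉ free x∈xs = contradiction (trans (sym free) (∈⇒occupied x∈xs)) λ ()

data UnitRun (n : ℕ) : List ℕ → {k : ℕ} → Vec ℕ k → Vec ℕ k → Set where
  [] : ∀ {occupiedSpots} → UnitRun n occupiedSpots [] []
  lucky : ∀ {occupiedSpots a k} {as ps : Vec ℕ k} →
    occupied a occupiedSpots ≡ false → a ≤ n →
    UnitRun n (a ∷ occupiedSpots) as ps → UnitRun n occupiedSpots (a ∷ as) (a ∷ ps)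
  unlucky : ∀ {occupiedSpots a k} {as ps : Vec ℕ k} →
    occupied a occupiedSpots ≡ true → occupied (suc a) occupiedSpots ≡ false → suc a ≤ n →
    UnitRun n (suc a ∷ occupiedSpots) as ps → UnitRun n occupiedSpots (a ∷ as) (suc a ∷ ps)

module _ (n : ℕ) (occupiedSpots : List ℕ) where

  firstFree-≥ : ∀ a f {s} → firstFree n a f occupiedSpots ≡ just s → a ≤ s
  firstFree-≥ a (suc f) h with a ≤? n
  ... | no _ = contradiction h λ ()
  ... | yes _ with occupied a occupiedSpots
  ...   | true = <⇒≤ (firstFree-≥ (suc a) f h)
  ...   | false = ≤-reflexive (just-injective h)

  firstFree-free : ∀ a f → occupied a occupiedSpots ≡ false → a ≤ n →
    firstFree n a (suc f) occupiedSpots ≡ just a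
  firstFree-free a f free a≤n with a ≤? n
  ... | no a≰n = contradiction a≤n a≰n
  ... | yes _ rewrite free = refl

  firstFree-suc : ∀ a f {s} → firstFree n a (suc f) occupiedSpots ≡ just s →
    s ≡ a ⊎ (occupied a occupiedSpots ≡ true × firstFree n (suc a) f occupiedSpots ≡ just s)
  firstFree-suc a f h with a ≤? n
  ... | no _ = contradiction h λ ()
  ... | yes _ with occupied a occupiedSpots
  ...   | true = inj₂ (refl , h)
  ...   | false = inj₁ (sym (just-injective h))

  firstFree-next : ∀ a f → occupied a occupiedSpots ≡ true → occupied (suc a) occupiedSpots ≡ false →
    suc a ≤ n → firstFree n a (suc (suc f)) occupiedSpots ≡ just (suc a)
  firstFree-next a f taken free sa≤n with a ≤? n
  ... | no a≰n = contradiction (<⇒≤ sa≤n) a≰n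
  ... | yes _ rewrite taken = firstFree-free (suc a) f free sa≤n

  firstFree-self : ∀ a f → firstFree n a f occupiedSpots ≡ just a → occupied a occupiedSpots ≡ false × a ≤ n
  firstFree-self a (suc f) h with a ≤? n
  ... | no _ = contradiction h λ ()
  ... | yes a≤n with occupied a occupiedSpots
  ...   | true = contradiction (firstFree-≥ (suc a) f h) (n≮n a)
  ...   | false = refl , a≤n

  parkFrom-∷⁻ : ∀ a {k} (as : Vec ℕ k) p ps → parkFrom n occupiedSpots (a ∷ as) ≡ just (p ∷ ps) →
    firstFree n a (suc n) occupiedSpots ≡ just p × parkFrom n (p ∷ occupiedSpots) as ≡ just ps
  parkFrom-∷⁻ a as p ps h with firstFree n a (suc n) occupiedSpots
  ... | nothing = contradiction h λ ()
  ... | just s with parkFrom n (s ∷ occupiedSpots) as in rest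
  ...   | nothing = contradiction h λ ()
  ...   | just _ with refl ← h = refl , rest

unitRun⇒parkFrom : ∀ {n occupiedSpots k} {as ps : Vec ℕ k} →
  UnitRun n occupiedSpots as ps → parkFrom n occupiedSpots as ≡ just ps
unitRun⇒parkFrom [] = refl
unitRun⇒parkFrom {n} {occupiedSpots} (lucky {a = a} free a≤n run)
  rewrite firstFree-free n occupiedSpots a n free a≤n | unitRun⇒parkFrom run = refl
unitRun⇒parkFrom {zero} (unlucky _ _ () _)
unitRun⇒parkFrom {suc m} {occupiedSpots} (unlucky {a = a} taken free sa≤n run)
  rewrite firstFree-next (suc m) occupiedSpots a m taken free sa≤n | unitRun⇒parkFrom run = refl

unitRun⇒unitInterval : ∀ {n occupiedSpots k} {as ps : Vec ℕ k} →
  UnitRun n occupiedSpots as ps → T (unitInterval as ps)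
unitRun⇒unitInterval [] = _
unitRun⇒unitInterval (lucky {a = a} _ _ run) = Equivalence.from T-∧
  (Equivalence.from (T-∨ {⌊ a ≟ a ⌋}) (inj₁ (fromWitness refl)) , unitRun⇒unitInterval run)
unitRun⇒unitInterval (unlucky {a = a} _ _ _ run) = Equivalence.from T-∧
  (Equivalence.from (T-∨ {⌊ suc a ≟ a ⌋}) (inj₂ (fromWitness refl)) , unitRun⇒unitInterval run)

unitInterval-∷⁻ : ∀ {k} {a p} {as ps : Vec ℕ k} → T (unitInterval (a ∷ as) (p ∷ ps)) →
  (p ≡ a ⊎ p ≡ suc a) × T (unitInterval as ps)
unitInterval-∷⁻ {a = a} {p} t with Equivalence.to (T-∧ {⌊ p ≟ a ⌋ ∨ ⌊ p ≟ suc a ⌋}) t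
... | head , rest with Equivalence.to (T-∨ {⌊ p ≟ a ⌋}) head
...   | inj₁ p≡a = inj₁ (toWitness p≡a) , rest
...   | inj₂ p≡sa = inj₂ (toWitness p≡sa) , rest

parkFrom⇒unitRun : ∀ {n occupiedSpots k} (as ps : Vec ℕ k) →
  parkFrom n occupiedSpots as ≡ just ps → T (unitInterval as ps) → UnitRun n occupiedSpots as ps
parkFrom⇒unitRun [] [] _ _ = []
parkFrom⇒unitRun {n} {occupiedSpots} (a ∷ as) (p ∷ ps) h ui
  with parkFrom-∷⁻ n occupiedSpots a as p ps h | unitInterval-∷⁻ {a = a} {p} {as} {ps} ui
... | parks-at-p , rest | inj₁ refl , ui′ =
  let free , a≤n = firstFree-self n occupiedSpots a (suc n) parks-at-p
  in lucky free a≤n (parkFrom⇒unitRun as ps rest ui′)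
... | parks-at-p , rest | inj₂ refl , ui′ with firstFree-suc n occupiedSpots a n parks-at-p
...   | inj₁ sa≡a = contradiction sa≡a 1+n≢n
...   | inj₂ (taken , parks-next) =
  let free , sa≤n = firstFree-self n occupiedSpots (suc a) n parks-next
  in unlucky taken free sa≤n (parkFrom⇒unitRun as ps rest ui′)

unitRun-∷ : ∀ {n occupiedSpots a p k} {as ps : Vec ℕ k} → p ≤ n → occupied p occupiedSpots ≡ false →
  p ≡ a ⊎ (p ≡ suc a × occupied a occupiedSpots ≡ true) →
  UnitRun n (p ∷ occupiedSpots) as ps → UnitRun n occupiedSpots (a ∷ as) (p ∷ ps)
unitRun-∷ p≤n free (inj₁ refl) run = lucky free p≤n run
unitRun-∷ p≤n free (inj₂ (refl , taken)) run = unlucky taken free p≤n run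

-- Entries (spot , rank of the car parked there), most recent first.
Table : Set
Table = List (ℕ × ℕ)

spotsOf : Table → List ℕ
spotsOf = map proj₁

ranksOf : Table → List ℕ
ranksOf = map proj₂

rankAt : ℕ → Table → Maybe ℕ
rankAt a [] = nothing
rankAt a ((s , ℓ) ∷ table) = if ⌊ a ≟ s ⌋ then just ℓ else rankAt a table

parkedEntry : ℕ → Maybe ℕ → ℕ × ℕ
parkedEntry a nothing = a , a
parkedEntry a (just ℓ) = suc a , ℓ

decode : ∀ {k} → Table → Vec ℕ k → Vec ℕ k
decode table [] = []
decode table (a ∷ as) = proj₂ entry ∷ decode (entry ∷ table) as
  where entry = parkedEntry a (rankAt a table)

decodeTable : ∀ {k} → Table → Vec ℕ k → Table
decodeTable table [] = table
decodeTable table (a ∷ as) = decodeTable (parkedEntry a (rankAt a table) ∷ table) as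

module _ {a : ℕ} where

  rankAt⇒∈ : ∀ {ℓ} table → rankAt a table ≡ just ℓ → (a , ℓ) ∈ table
  rankAt⇒∈ ((s , _) ∷ table) h with a ≟ s
  rankAt⇒∈ ((s , _) ∷ table) refl | yes refl = here refl
  ... | no _ = there (rankAt⇒∈ table h)

  rankAt-free : ∀ table → occupied a (spotsOf table) ≡ false → rankAt a table ≡ nothing
  rankAt-free [] _ = refl
  rankAt-free ((s , _) ∷ table) free with a ≟ s
  ... | yes _ = contradiction free λ ()
  ... | no _ = rankAt-free table free

  rankAt-taken : ∀ table → occupied a (spotsOf table) ≡ true → ∃ λ ℓ → rankAt a table ≡ just ℓ
  rankAt-taken ((s , ℓ) ∷ table) taken with a ≟ s
  ... | yes _ = ℓ , refl
  ... | no _ = rankAt-taken table taken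

  ∈-table⇒occupied : ∀ {ℓ} table → (a , ℓ) ∈ table → occupied a (spotsOf table) ≡ true
  ∈-table⇒occupied table entry = ∈⇒occupied (∈-map⁺ proj₁ entry)

  unoccupied⇒∉-table : ∀ {ℓ} table → occupied a (spotsOf table) ≡ false → ¬ (a , ℓ) ∈ table
  unoccupied⇒∉-table table free entry = unoccupied⇒∉ free (∈-map⁺ proj₁ entry)

  ∉-table⇒unoccupied : ∀ table → (∀ {ℓ} → ¬ (a , ℓ) ∈ table) → occupied a (spotsOf table) ≡ false
  ∉-table⇒unoccupied table h = ∉⇒unoccupied λ a∈spots → h′ (∈-map⁻ proj₁ a∈spots)
    where
    h′ : ¬ ∃ λ entry → entry ∈ table × a ≡ proj₁ entry
    h′ (_ , entry , refl) = h entry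

-- From rankings to unit interval parking functions

-- `seen` lists the ranks of the cars already processed.
toPreference : ∀ {k} → List ℕ → Vec ℕ k → Vec ℕ k
toPreference seen [] = []
toPreference seen (x ∷ xs) = x + pred (multiplicity x seen) ∷ toPreference (x ∷ seen) xs

toOutcome : ∀ {k} → List ℕ → Vec ℕ k → Vec ℕ k
toOutcome seen [] = []
toOutcome seen (x ∷ xs) = x + multiplicity x seen ∷ toOutcome (x ∷ seen) xs

toTable : List ℕ → Table
toTable [] = []
toTable (x ∷ seen) = (x + multiplicity x seen , x) ∷ toTable seen

toTable-∈ : ∀ seen {s v} → (s , v) ∈ toTable seen → v ≤ s × s < v + multiplicity v seen
toTable-∈ (x ∷ seen) (here refl) rewrite multiplicity-here x seen = m≤m+n x _ , +-monoʳ-< x ≤-refl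
toTable-∈ (x ∷ seen) {s} {v} (there entry) =
  let v≤s , s<end = toTable-∈ seen entry
  in v≤s , <-≤-trans s<end (+-monoʳ-≤ v (multiplicity-∷ v x seen))

toTable-rank∈ : ∀ seen {s v} → (s , v) ∈ toTable seen → v ∈ seen
toTable-rank∈ (x ∷ seen) (here refl) = here refl
toTable-rank∈ (x ∷ seen) (there entry) = there (toTable-rank∈ seen entry)

toTable-last : ∀ seen x → 0 < multiplicity x seen → (x + pred (multiplicity x seen) , x) ∈ toTable seen
toTable-last (y ∷ seen) x pos with y ≟ x
... | yes refl = here refl
... | no _ = there (toTable-last seen x pos)

module Encoding (n : ℕ) (B : List ℕ) (rank : IsCompetitionRanking B) (length≡n : length B ≡ n) where

  blocks-disjoint : ∀ {v w} → v ∈ B → w ∈ B → v < w → v + multiplicity v B ≤ w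
  blocks-disjoint {v} {w} v∈B w∈B v<w = begin
    v + multiplicity v B                  ≡⟨ cong (_+ multiplicity v B) (rank v∈B) ⟩
    suc (countBelow v B + multiplicity v B) ≡⟨ cong suc (countAtMost≡countBelow+multiplicity v B) ⟨
    suc (countᵇ (λ x → ⌊ x ≤? v ⌋) B)     ≤⟨ s≤s (countᵇ-mono _ _ B at-most-v⇒below-w) ⟩
    suc (countBelow w B)                  ≡⟨ rank w∈B ⟨
    w                                     ∎
    where
    open ≤-Reasoning
    at-most-v⇒below-w : ∀ {x} → x ∈ B → ⌊ x ≤? v ⌋ ≡ true → ⌊ x <? w ⌋ ≡ true
    at-most-v⇒below-w {x} _ x≤v = ⌊⌋-true (x <? w) (≤-<-trans (⌊⌋-true⁻ (x ≤? v) x≤v) v<w)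

  block-bounded : ∀ {v} → v ∈ B → v + multiplicity v B ≤ suc n
  block-bounded {v} v∈B = begin
    v + multiplicity v B                    ≡⟨ cong (_+ multiplicity v B) (rank v∈B) ⟩
    suc (countBelow v B + multiplicity v B) ≤⟨ s≤s (countBelow+multiplicity≤length v B) ⟩
    suc (length B)                          ≡⟨ cong suc length≡n ⟩
    suc n                                   ∎
    where open ≤-Reasoning

  Remaining : ∀ {k} → List ℕ → Vec ℕ k → Set
  Remaining seen xs = ∀ v → multiplicity v seen + multiplicity v (toList xs) ≡ multiplicity v B

  remaining-∷ : ∀ {k} seen x (xs : Vec ℕ k) → Remaining seen (x ∷ xs) → Remaining (x ∷ seen) xs
  remaining-∷ seen x xs h v = trans (xy∙z≈y∙xz (bit ⌊ x ≟ v ⌋) (multiplicity v seen) _) (h v)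

  seen≤ : ∀ {k} seen (xs : Vec ℕ k) → Remaining seen xs → ∀ v → multiplicity v seen ≤ multiplicity v B
  seen≤ seen xs h v = ≤-trans (m≤m+n _ _) (≤-reflexive (h v))

  head-unseen : ∀ {k} seen x (xs : Vec ℕ k) → Remaining seen (x ∷ xs) → multiplicity x seen < multiplicity x B
  head-unseen seen x xs h = begin-strict
    multiplicity x seen
      <⟨ m<m+n _ (multiplicity>0 {x} {x ∷ toList xs} (here refl)) ⟩
    multiplicity x seen + multiplicity x (x ∷ toList xs)
      ≡⟨ h x ⟩
    multiplicity x B
      ∎
    where open ≤-Reasoning

  head∈B : ∀ {k} seen x (xs : Vec ℕ k) → Remaining seen (x ∷ xs) → x ∈ B
  head∈B seen x xs h = multiplicity>0⁻ (≤-<-trans z≤n (head-unseen seen x xs h))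

  seen⇒∈B : ∀ {k} seen (xs : Vec ℕ k) → Remaining seen xs → ∀ {v} → v ∈ seen → v ∈ B
  seen⇒∈B seen xs h {v} v∈seen = multiplicity>0⁻ (<-≤-trans (multiplicity>0 v∈seen) (seen≤ seen xs h v))

  module _ {k} (seen : List ℕ) (x : ℕ) (xs : Vec ℕ k) (h : Remaining seen (x ∷ xs)) where
    private
      table = toTable seen
      x∈B = head∈B seen x xs h
      v∈B : ∀ {s v} → (s , v) ∈ table → v ∈ B
      v∈B entry = seen⇒∈B seen (x ∷ xs) h (toTable-rank∈ seen entry)

    occupant-rank : ∀ {s v} → (s , v) ∈ table → x ≤ s → s < x + multiplicity x B → v ≡ x
    occupant-rank {s} {v} entry x≤s s<end with toTable-∈ seen entry
    ... | v≤s , s<v-end with <-cmp v x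
    ...   | tri≈ _ v≡x _ = v≡x
    ...   | tri< v<x _ _ = contradiction
      (≤-trans (+-monoʳ-≤ v (seen≤ seen (x ∷ xs) h v)) (≤-trans (blocks-disjoint (v∈B entry) x∈B v<x) x≤s))
      (<⇒≱ s<v-end)
    ...   | tri> _ _ x<v = contradiction (≤-trans (blocks-disjoint x∈B (v∈B entry) x<v) v≤s) (<⇒≱ s<end)

    private
      next-spot<end : x + multiplicity x seen < x + multiplicity x B
      next-spot<end = +-monoʳ-< x (head-unseen seen x xs h)

    next-spot-≤n : x + multiplicity x seen ≤ n
    next-spot-≤n = ≤-pred (≤-trans next-spot<end (block-bounded x∈B))

    next-spot-free : occupied (x + multiplicity x seen) (spotsOf table) ≡ false
    next-spot-free = ∉-table⇒unoccupied table λ entry →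
      not-yet-parked entry (occupant-rank entry (m≤m+n x _) next-spot<end)
      where
      not-yet-parked : ∀ {ℓ} → (x + multiplicity x seen , ℓ) ∈ table → ℓ ≢ x
      not-yet-parked entry refl = n≮n _ (proj₂ (toTable-∈ seen entry))

    module _ {c} (m≡ : multiplicity x seen ≡ suc c) where

      previous-taken : occupied (x + c) (spotsOf table) ≡ true
      previous-taken = ∈-table⇒occupied table
        (subst (λ m → (x + pred m , x) ∈ table) m≡ (toTable-last seen x (subst (0 <_) (sym m≡) (s≤s z≤n))))

      rankAt-previous : rankAt (x + c) table ≡ just x
      rankAt-previous with rankAt-taken table previous-taken
      ... | ℓ , rankAt≡ℓ = trans rankAt≡ℓ (cong just (occupant-rank (rankAt⇒∈ table rankAt≡ℓ) (m≤m+n x c)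
              (<-trans (+-monoʳ-< x ≤-refl) (subst (λ m → x + m < x + multiplicity x B) m≡ next-spot<end))))

    head-step : x + multiplicity x seen ≡ x + pred (multiplicity x seen)
      ⊎ (x + multiplicity x seen ≡ suc (x + pred (multiplicity x seen))
         × occupied (x + pred (multiplicity x seen)) (spotsOf table) ≡ true)
    head-step with multiplicity x seen in m≡
    ... | zero = inj₁ refl
    ... | suc c = inj₂ (+-suc x c , previous-taken m≡)

    head-entry : let a = x + pred (multiplicity x seen) in
      parkedEntry a (rankAt a table) ≡ (x + multiplicity x seen , x)
    head-entry with multiplicity x seen in m≡
    ... | zero = trans (cong (parkedEntry (x + 0)) (rankAt-free table free)) (cong (x + 0 ,_) (+-identityʳ x))
      where free = subst (λ m → occupied (x + m) (spotsOf table) ≡ false) m≡ next-spot-free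
    ... | suc c = trans (cong (parkedEntry (x + c)) (rankAt-previous m≡)) (cong (_, x) (sym (+-suc x c)))

  rankRun : ∀ {k} seen (xs : Vec ℕ k) → Remaining seen xs →
    UnitRun n (spotsOf (toTable seen)) (toPreference seen xs) (toOutcome seen xs)
  rankRun seen [] h = []
  rankRun seen (x ∷ xs) h = unitRun-∷ (next-spot-≤n seen x xs h) (next-spot-free seen x xs h)
    (head-step seen x xs h) (rankRun (x ∷ seen) xs (remaining-∷ seen x xs h))

  decode-toPreference : ∀ {k} seen (xs : Vec ℕ k) → Remaining seen xs →
    decode (toTable seen) (toPreference seen xs) ≡ xs
  decode-toPreference seen [] h = refl
  decode-toPreference seen (x ∷ xs) h = cong₂ _∷_ (cong proj₂ (head-entry seen x xs h)) (begin
    decode (_ ∷ toTable seen) rest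
      ≡⟨ cong (λ e → decode (e ∷ toTable seen) rest) (head-entry seen x xs h) ⟩
    decode (toTable (x ∷ seen)) rest
      ≡⟨ decode-toPreference (x ∷ seen) xs (remaining-∷ seen x xs h) ⟩
    xs
      ∎)
    where
    open ≡-Reasoning
    rest = toPreference (x ∷ seen) xs

-- From unit interval parking functions to rankings

record Blocks (table : Table) : Set where
  field
    within-block : ∀ {s ℓ} → (s , ℓ) ∈ table → ℓ ≤ s × s < ℓ + multiplicity ℓ (ranksOf table)
    fills-block : ∀ {s ℓ} → (s , ℓ) ∈ table → ∀ t → ℓ ≤ t → t < ℓ + multiplicity ℓ (ranksOf table) →
      (t , ℓ) ∈ table
open Blocks

module _ {table : Table} (blocks : Blocks table) where

  block-start∈ : ∀ {s ℓ} → (s , ℓ) ∈ table → (ℓ , ℓ) ∈ table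
  block-start∈ {ℓ = ℓ} entry =
    fills-block blocks entry ℓ ≤-refl (m<m+n ℓ (multiplicity>0 (∈-map⁺ proj₂ entry)))

  free⇒rank-absent : ∀ {a} → occupied a (spotsOf table) ≡ false → multiplicity a (ranksOf table) ≡ 0
  free⇒rank-absent {a} free with multiplicity a (ranksOf table) in m≡
  ... | zero = refl
  ... | suc _ with ∈-map⁻ proj₂ (multiplicity>0⁻ {a} {ranksOf table} (subst (0 <_) (sym m≡) (s≤s z≤n)))
  ...   | _ , entry , refl = contradiction (block-start∈ entry) (unoccupied⇒∉-table table free)

  within-block-∷ : ∀ r {s ℓ} → (s , ℓ) ∈ table → ℓ ≤ s × s < ℓ + multiplicity ℓ (r ∷ ranksOf table)
  within-block-∷ r {ℓ = ℓ} e =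
    let ℓ≤s , s<end = within-block blocks e
    in ℓ≤s , <-≤-trans s<end (+-monoʳ-≤ ℓ (multiplicity-∷ ℓ r (ranksOf table)))

  blocks-lucky : ∀ {a} → occupied a (spotsOf table) ≡ false → Blocks ((a , a) ∷ table)
  blocks-lucky {a} free = record { within-block = within ; fills-block = fills }
    where
    absent = free⇒rank-absent free
    within : ∀ {s ℓ} → (s , ℓ) ∈ (a , a) ∷ table → ℓ ≤ s × s < ℓ + multiplicity ℓ (a ∷ ranksOf table)
    within (here refl) rewrite multiplicity-here a (ranksOf table) | absent = ≤-refl , m<m+n a (s≤s z≤n)
    within (there e) = within-block-∷ a e
    fills : ∀ {s ℓ} → (s , ℓ) ∈ (a , a) ∷ table → ∀ t → ℓ ≤ t → t < ℓ + multiplicity ℓ (a ∷ ranksOf table) →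
      (t , ℓ) ∈ (a , a) ∷ table
    fills (here refl) t a≤t t<end rewrite multiplicity-here a (ranksOf table) | absent | +-comm a 1 =
      here (cong (_, a) (≤-antisym (≤-pred t<end) a≤t))
    fills {ℓ = ℓ} (there e) t ℓ≤t t<end =
      there (fills-block blocks e t ℓ≤t
        (subst (λ m → t < ℓ + m) (multiplicity-there (ranksOf table) a≢ℓ) t<end))
      where
      a≢ℓ : a ≢ ℓ
      a≢ℓ refl = <⇒≢ (multiplicity>0 (∈-map⁺ proj₂ e)) (sym absent)

  module _ {a ℓ} (rank-a : rankAt a table ≡ just ℓ) (free : occupied (suc a) (spotsOf table) ≡ false) where
    private
      entry = rankAt⇒∈ table rank-a
      #ℓ = multiplicity ℓ (ranksOf table)

    unlucky-spot≡block-end : suc a ≡ ℓ + #ℓ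
    unlucky-spot≡block-end with within-block blocks entry | suc a <? ℓ + #ℓ
    ... | ℓ≤a , _ | yes sa<end = contradiction
      (fills-block blocks entry (suc a) (≤-trans ℓ≤a (n≤1+n a)) sa<end) (unoccupied⇒∉-table table free)
    ... | _ , a<end | no sa≮end = ≤-antisym a<end (≮⇒≥ sa≮end)

    blocks-unlucky : Blocks ((suc a , ℓ) ∷ table)
    blocks-unlucky = record { within-block = within ; fills-block = fills }
      where
      within : ∀ {s r} → (s , r) ∈ (suc a , ℓ) ∷ table → r ≤ s × s < r + multiplicity r (ℓ ∷ ranksOf table)
      within (here refl) rewrite multiplicity-here ℓ (ranksOf table) =
        ≤-trans (proj₁ (within-block blocks entry)) (n≤1+n a) ,
        subst (_< ℓ + suc #ℓ) (sym unlucky-spot≡block-end) (+-monoʳ-< ℓ ≤-refl)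
      within (there e) = within-block-∷ ℓ e
      fills-ℓ : ∀ t → ℓ ≤ t → t < ℓ + multiplicity ℓ (ℓ ∷ ranksOf table) → (t , ℓ) ∈ (suc a , ℓ) ∷ table
      fills-ℓ t ℓ≤t t<end rewrite multiplicity-here ℓ (ranksOf table) with t ≟ ℓ + #ℓ
      ... | yes refl = here (cong (_, ℓ) (sym unlucky-spot≡block-end))
      ... | no t≢end =
        there (fills-block blocks entry t ℓ≤t (≤∧≢⇒< (≤-pred (subst (t <_) (+-suc ℓ #ℓ) t<end)) t≢end))
      fills : ∀ {s r} → (s , r) ∈ (suc a , ℓ) ∷ table →
        ∀ t → r ≤ t → t < r + multiplicity r (ℓ ∷ ranksOf table) → (t , r) ∈ (suc a , ℓ) ∷ table
      fills (here refl) = fills-ℓ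
      fills {r = r} (there e) t r≤t t<end with r ≟ ℓ
      ... | yes refl = fills-ℓ t r≤t t<end
      ... | no r≢ℓ = there (fills-block blocks e t r≤t
        (subst (λ m → t < r + m) (multiplicity-there (ranksOf table) (r≢ℓ ∘′ sym)) t<end))

data Distinct : List ℕ → Set where
  [] : Distinct []
  _∷_ : ∀ {x xs} → occupied x xs ≡ false → Distinct xs → Distinct (x ∷ xs)

∉⇒multiplicity≡0 : ∀ {x xs} → ¬ x ∈ xs → multiplicity x xs ≡ 0
∉⇒multiplicity≡0 {x} {xs} x∉xs = countᵇ≡0 _ xs λ {y} y∈xs → ⌊⌋-false (y ≟ x) λ { refl → x∉xs y∈xs }

distinct⇒multiplicity≤1 : ∀ {xs} → Distinct xs → ∀ v → multiplicity v xs ≤ 1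
distinct⇒multiplicity≤1 [] v = z≤n
distinct⇒multiplicity≤1 {x ∷ xs} (free ∷ distinct) v = by-head (x ≟ v)
  where
  by-head : Dec (x ≡ v) → multiplicity v (x ∷ xs) ≤ 1
  by-head (yes refl) = ≤-reflexive
    (trans (multiplicity-here x xs) (cong suc (∉⇒multiplicity≡0 (unoccupied⇒∉ {x} {xs} free))))
  by-head (no x≢v) = ≤-trans (≤-reflexive (multiplicity-there xs x≢v)) (distinct⇒multiplicity≤1 distinct v)

distinct-spots⇒functional : ∀ {table s x y} → Distinct (spotsOf table) →
  (s , x) ∈ table → (s , y) ∈ table → x ≡ y
distinct-spots⇒functional (_ ∷ _) (here refl) (here refl) = refl
distinct-spots⇒functional {_ ∷ table} (free ∷ _) (here refl) (there e) =
  contradiction e (unoccupied⇒∉-table table free)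
distinct-spots⇒functional {_ ∷ table} (free ∷ _) (there e) (here refl) =
  contradiction e (unoccupied⇒∉-table table free)
distinct-spots⇒functional (_ ∷ distinct) (there e) (there e′) = distinct-spots⇒functional distinct e e′

countᵇ-window : ∀ {xs} → Distinct xs → (p : ℕ → Bool) (lo d : ℕ) →
  (∀ {x} → x ∈ xs → p x ≡ true → lo ≤ x × x < lo + d) → countᵇ p xs ≤ d
countᵇ-window {xs} _ p lo zero window = ≤-reflexive (countᵇ≡0 p xs outside)
  where
  outside : ∀ {x} → x ∈ xs → p x ≡ false
  outside {x} x∈xs with p x in px
  ... | false = refl
  ... | true = let lo≤x , x<lo+0 = window x∈xs px
               in contradiction (≤-trans (≤-reflexive (+-identityʳ lo)) lo≤x) (<⇒≱ x<lo+0)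
countᵇ-window {xs} distinct p lo (suc d) window = begin
  countᵇ p xs
    ≡⟨ countᵇ-split p at-top below-top xs (λ {x} _ → split x) ⟩
  countᵇ at-top xs + countᵇ below-top xs
    ≤⟨ +-mono-≤ at-most-one (countᵇ-window distinct below-top lo d window′) ⟩
  1 + d
    ∎
  where
  open ≤-Reasoning
  at-top below-top : ℕ → Bool
  at-top x = p x ∧ ⌊ x ≟ lo + d ⌋
  below-top x = p x ∧ not ⌊ x ≟ lo + d ⌋
  split : ∀ x → bit (p x) ≡ bit (at-top x) + bit (below-top x)
  split x with p x | ⌊ x ≟ lo + d ⌋
  ... | true | true = refl
  ... | true | false = refl
  ... | false | _ = refl
  at-most-one : countᵇ at-top xs ≤ 1
  at-most-one = ≤-trans (countᵇ-mono at-top _ xs top) (distinct⇒multiplicity≤1 distinct (lo + d))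
    where
    top : ∀ {x} → x ∈ xs → at-top x ≡ true → ⌊ x ≟ lo + d ⌋ ≡ true
    top {x} _ h with p x
    ... | true = h
  window′ : ∀ {x} → x ∈ xs → below-top x ≡ true → lo ≤ x × x < lo + d
  window′ {x} x∈xs h with p x in px | x ≟ lo + d
  ... | true | no x≢top =
    let lo≤x , x<top = window x∈xs px in lo≤x , ≤∧≢⇒< (≤-pred (subst (x <_) (+-suc lo d) x<top)) x≢top

countBelow-distinct : ∀ {xs} n → Distinct xs → (∀ {x} → x ∈ xs → 1 ≤ x × x ≤ n) → length xs ≡ n →
  ∀ u → u ≤ n → countBelow (suc u) xs ≡ u
countBelow-distinct {xs} n distinct range length≡n u u≤n = ≤-antisym below≤u u≤below
  where
  below = countBelow (suc u) xs
  above = countᵇ (not ∘′ λ x → ⌊ x <? suc u ⌋) xs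
  below≤u : below ≤ u
  below≤u = countᵇ-window distinct _ 1 u λ {x} x∈xs x<1+u → proj₁ (range x∈xs) , ⌊⌋-true⁻ (x <? suc u) x<1+u
  above≤rest : above ≤ n ∸ u
  above≤rest = countᵇ-window distinct _ (suc u) (n ∸ u) window
    where
    window : ∀ {x} → x ∈ xs → not ⌊ x <? suc u ⌋ ≡ true → suc u ≤ x × x < suc u + (n ∸ u)
    window {x} x∈xs h with x <? suc u
    ... | no x≮1+u = ≮⇒≥ x≮1+u , s≤s (≤-trans (proj₂ (range x∈xs)) (≤-reflexive (sym (m+[n∸m]≡n u≤n))))
  total : below + above ≡ u + (n ∸ u)
  total = trans (countᵇ+countᵇ-not _ xs) (trans length≡n (sym (m+[n∸m]≡n u≤n)))
  u≤below : u ≤ below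
  u≤below with u ≤? below
  ... | yes u≤b = u≤b
  ... | no u≰b = contradiction total (<⇒≢ (+-mono-<-≤ (≰⇒> u≰b) above≤rest))

length-decodeTable : ∀ {k} table (as : Vec ℕ k) → length (decodeTable table as) ≡ k + length table
length-decodeTable table [] = refl
length-decodeTable {suc k} table (a ∷ as) = trans (length-decodeTable _ as) (+-suc k _)

ranksOf-decodeTable : ∀ {k} (p : ℕ → Bool) table (as : Vec ℕ k) →
  countᵇ p (ranksOf (decodeTable table as)) ≡ countᵇ p (toList (decode table as)) + countᵇ p (ranksOf table)
ranksOf-decodeTable p table [] = refl
ranksOf-decodeTable p table (a ∷ as) =
  trans (ranksOf-decodeTable p (parkedEntry a (rankAt a table) ∷ table) as)
    (x∙yz≈yx∙z _ (bit (p (proj₂ (parkedEntry a (rankAt a table))))) _)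

m+n≡1+o⇒m+pred[n]≡o : ∀ m {n o} → suc o ≡ m + n → 0 < n → m + pred n ≡ o
m+n≡1+o⇒m+pred[n]≡o m {suc n} eq _ = suc-injective (trans (sym (+-suc m n)) (sym eq))

module Decoding (n : ℕ) where

  record Invariant (table : Table) : Set where
    field
      blocks : Blocks table
      distinct : Distinct (spotsOf table)
      inRange : ∀ {s ℓ} → (s , ℓ) ∈ table → 1 ≤ s × s ≤ n
  open Invariant

  module _ {table : Table} (inv : Invariant table) where

    invariant-lucky : ∀ {a} → occupied a (spotsOf table) ≡ false → 1 ≤ a → a ≤ n → Invariant ((a , a) ∷ table)
    invariant-lucky free 1≤a a≤n = record
      { blocks = blocks-lucky (blocks inv) free
      ; distinct = free ∷ distinct inv
      ; inRange = λ { (here refl) → 1≤a , a≤n ; (there e) → inRange inv e }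
      }

    invariant-unlucky : ∀ {a ℓ} → rankAt a table ≡ just ℓ → occupied (suc a) (spotsOf table) ≡ false →
      suc a ≤ n → Invariant ((suc a , ℓ) ∷ table)
    invariant-unlucky rank-a free sa≤n = record
      { blocks = blocks-unlucky (blocks inv) rank-a free
      ; distinct = free ∷ distinct inv
      ; inRange = λ { (here refl) → s≤s z≤n , sa≤n ; (there e) → inRange inv e }
      }

  DecodesTo : ∀ {k} → Table → Vec ℕ k → Vec ℕ k → Set
  DecodesTo table as ps = toPreference (ranksOf table) (decode table as) ≡ as
    × toOutcome (ranksOf table) (decode table as) ≡ ps × Invariant (decodeTable table as)

  decodeRun : ∀ {k} table {as ps : Vec ℕ k} → UnitRun n (spotsOf table) as ps → VAll (1 ≤_) as →
    Invariant table → DecodesTo table as ps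
  decodeRun table [] [] inv = refl , refl , inv
  decodeRun table {a ∷ as} {.a ∷ ps} (lucky free a≤n run) (1≤a ∷ pos) inv
    rewrite rankAt-free table free
    with decodeRun ((a , a) ∷ table) run pos (invariant-lucky inv free 1≤a a≤n)
  ... | pref , out , inv′ rewrite free⇒rank-absent (blocks inv) free =
    cong₂ _∷_ (+-identityʳ a) pref , cong₂ _∷_ (+-identityʳ a) out , inv′
  decodeRun table {a ∷ as} {.(suc a) ∷ ps} (unlucky taken free sa≤n run) (_ ∷ pos) inv
    with rankAt-taken table taken
  ... | ℓ , rank-a rewrite rank-a
    with decodeRun ((suc a , ℓ) ∷ table) run pos (invariant-unlucky inv rank-a free sa≤n)
  ... | pref , out , inv′ = cong₂ _∷_ head-preference pref , cong₂ _∷_ (sym block-end) out , inv′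
    where
    block-end = unlucky-spot≡block-end (blocks inv) rank-a free
    head-preference : ℓ + pred (multiplicity ℓ (ranksOf table)) ≡ a
    head-preference = m+n≡1+o⇒m+pred[n]≡o ℓ block-end (multiplicity>0 (∈-map⁺ proj₂ (rankAt⇒∈ table rank-a)))

  module _ {table : Table} (inv : Invariant table) (length≡n : length table ≡ n) where

    rank<⇔spot< : ∀ {v} → (v , v) ∈ table →
      ∀ {entry} → entry ∈ table → ⌊ proj₂ entry <? v ⌋ ≡ ⌊ proj₁ entry <? v ⌋
    rank<⇔spot< {v} start {s , ℓ} entry with within-block (blocks inv) entry | ℓ <? v
    ... | ℓ≤s , _ | no ℓ≮v = sym (⌊⌋-false (s <? v) λ s<v → ℓ≮v (≤-<-trans ℓ≤s s<v))
    ... | _ , s<end | yes ℓ<v = sym (⌊⌋-true (s <? v) s<v)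
      where
      s<v : s < v
      s<v with s <? v
      ... | yes s<v = s<v
      ... | no s≮v = contradiction (distinct-spots⇒functional (distinct inv) ℓ-at-v start) (<⇒≢ ℓ<v)
        where ℓ-at-v = fills-block (blocks inv) entry v (<⇒≤ ℓ<v) (≤-<-trans (≮⇒≥ s≮v) s<end)

    ranksOf-competition : IsCompetitionRanking (ranksOf table)
    ranksOf-competition {v} v∈ranks with ∈-map⁻ proj₂ v∈ranks
    ... | (s , .v) , entry , refl with block-start∈ (blocks inv) entry
    ...   | start with inRange inv start
    ...     | s≤s z≤n , v≤n = cong suc (sym (begin
      countBelow v (ranksOf table)
        ≡⟨ countᵇ-map _ proj₂ table ⟩
      countᵇ (λ e → ⌊ proj₂ e <? v ⌋) table
        ≡⟨ countᵇ-cong _ _ table (rank<⇔spot< start) ⟩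
      countᵇ (λ e → ⌊ proj₁ e <? v ⌋) table
        ≡⟨ countᵇ-map _ proj₁ table ⟨
      countBelow v (spotsOf table)
        ≡⟨ countBelow-distinct n (distinct inv) spot-range length-spots (pred v) (≤-trans (n≤1+n _) v≤n) ⟩
      pred v
        ∎))
      where
      open ≡-Reasoning
      spot-range : ∀ {x} → x ∈ spotsOf table → 1 ≤ x × x ≤ n
      spot-range x∈spots with ∈-map⁻ proj₁ x∈spots
      ... | _ , e , refl = inRange inv e
      length-spots : length (spotsOf table) ≡ n
      length-spots = trans (length-map proj₁ table) length≡n

  decode-competition : (as : Vec ℕ n) → Invariant (decodeTable [] as) →
    IsCompetitionRanking (toList (decode [] as))
  decode-competition as inv {v} v∈ =
    trans (ranksOf-competition inv length≡n v∈ranks) (cong suc (same-counts _))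
    where
    same-counts : ∀ p → countᵇ p (ranksOf (decodeTable [] as)) ≡ countᵇ p (toList (decode [] as))
    same-counts p = trans (ranksOf-decodeTable p [] as) (+-identityʳ _)
    length≡n : length (decodeTable [] as) ≡ n
    length≡n = trans (length-decodeTable [] as) (+-identityʳ n)
    v∈ranks : v ∈ ranksOf (decodeTable [] as)
    v∈ranks = multiplicity>0⁻ (subst (0 <_) (sym (same-counts _)) (multiplicity>0 v∈))

-- Lucky cars and ranks

luckyCount-∷ : ∀ {k} a p (as ps : Vec ℕ k) → luckyCount (a ∷ as) (p ∷ ps) ≡ bit ⌊ a ≟ p ⌋ + luckyCount as ps
luckyCount-∷ a p as ps with a ≟ p
... | yes _ = refl
... | no _ = refl

newCount : ∀ {k} → List ℕ → Vec ℕ k → ℕ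
newCount seen [] = 0
newCount seen (x ∷ xs) = bit ⌊ multiplicity x seen ≟ 0 ⌋ + newCount (x ∷ seen) xs

luckyCount-toPreference : ∀ {k} seen (xs : Vec ℕ k) →
  luckyCount (toPreference seen xs) (toOutcome seen xs) ≡ newCount seen xs
luckyCount-toPreference seen [] = refl
luckyCount-toPreference seen (x ∷ xs) =
  trans (luckyCount-∷ _ _ (toPreference (x ∷ seen) xs) (toOutcome (x ∷ seen) xs))
    (cong₂ _+_ (lucky⇔new (multiplicity x seen)) (luckyCount-toPreference (x ∷ seen) xs))
  where
  lucky⇔new : ∀ m → bit ⌊ x + pred m ≟ x + m ⌋ ≡ bit ⌊ m ≟ 0 ⌋
  lucky⇔new zero rewrite ⌊⌋-true (x + 0 ≟ x + 0) refl = refl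
  lucky⇔new (suc m) rewrite ⌊⌋-false (x + m ≟ x + suc m) (<⇒≢ (+-monoʳ-< x ≤-refl)) = refl

multiplicity-upTo : ∀ x m → multiplicity x (upTo m) ≡ bit ⌊ x <? m ⌋
multiplicity-upTo x zero = refl
multiplicity-upTo x (suc m) = begin
  multiplicity x (upTo (suc m))                    ≡⟨ cong (multiplicity x) (upTo-∷ʳ m) ⟨
  multiplicity x (upTo m ++ m ∷ [])                ≡⟨ countᵇ-++ _ (upTo m) (m ∷ []) ⟩
  multiplicity x (upTo m) + (bit ⌊ m ≟ x ⌋ + 0)    ≡⟨ cong₂ _+_ (multiplicity-upTo x m) (+-identityʳ _) ⟩
  bit ⌊ x <? m ⌋ + bit ⌊ m ≟ x ⌋                   ≡⟨ below-suc ⟩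
  bit ⌊ x <? suc m ⌋                               ∎
  where
  open ≡-Reasoning
  below-suc : bit ⌊ x <? m ⌋ + bit ⌊ m ≟ x ⌋ ≡ bit ⌊ x <? suc m ⌋
  below-suc with x <? m
  ... | yes x<m rewrite ⌊⌋-false (m ≟ x) (<⇒≢ x<m ∘′ sym) | ⌊⌋-true (x <? suc m) (m<n⇒m<1+n x<m) = refl
  ... | no x≮m with m ≟ x
  ...   | yes refl rewrite ⌊⌋-true (m <? suc m) ≤-refl = refl
  ...   | no m≢x rewrite ⌊⌋-false (x <? suc m) (λ x<1+m → x≮m (≤∧≢⇒< (≤-pred x<1+m) (m≢x ∘′ sym))) = refl

valueCount : ℕ → List ℕ → ℕ
valueCount n xs = countᵇ (λ v → ⌊ 0 <? multiplicity v xs ⌋) (upTo (suc n))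

valueCount-∷ : ∀ n {x} xs → x < suc n →
  valueCount n (x ∷ xs) ≡ valueCount n xs + bit ⌊ multiplicity x xs ≟ 0 ⌋
valueCount-∷ n {x} xs x<1+n =
  trans (countᵇ-split _ _ (λ v → ⌊ v ≟ x ⌋ ∧ new) values (λ {v} _ → pointwise v (v ≟ x)))
    (cong (valueCount n xs +_) new-count)
  where
  values = upTo (suc n)
  new = ⌊ multiplicity x xs ≟ 0 ⌋
  pointwise : ∀ v → Dec (v ≡ x) →
    bit ⌊ 0 <? multiplicity v (x ∷ xs) ⌋ ≡ bit ⌊ 0 <? multiplicity v xs ⌋ + bit (⌊ v ≟ x ⌋ ∧ new)
  pointwise v (yes refl) rewrite multiplicity-here v xs | ⌊⌋-true (v ≟ v) refl with multiplicity v xs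
  ... | zero = refl
  ... | suc _ = refl
  pointwise v (no v≢x) rewrite multiplicity-there xs (v≢x ∘′ sym) | ⌊⌋-false (v ≟ x) v≢x = sym (+-identityʳ _)
  new-count : countᵇ (λ v → ⌊ v ≟ x ⌋ ∧ new) values ≡ bit new
  new-count with new
  ... | true = trans (countᵇ-cong _ _ values (λ {v} _ → ∧-identityʳ ⌊ v ≟ x ⌋))
                 (trans (multiplicity-upTo x (suc n)) (cong bit (⌊⌋-true (x <? suc n) x<1+n)))
  ... | false = countᵇ≡0 _ values (λ {v} _ → ∧-zeroʳ ⌊ v ≟ x ⌋)

multiplicity-++-∷ : ∀ v ys x zs → multiplicity v (ys ++ x ∷ zs) ≡ multiplicity v (x ∷ ys ++ zs)
multiplicity-++-∷ v ys x zs = begin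
  multiplicity v (ys ++ x ∷ zs)
    ≡⟨ countᵇ-++ _ ys (x ∷ zs) ⟩
  multiplicity v ys + (bit ⌊ x ≟ v ⌋ + multiplicity v zs)
    ≡⟨ x∙yz≈y∙xz (multiplicity v ys) (bit ⌊ x ≟ v ⌋) (multiplicity v zs) ⟩
  bit ⌊ x ≟ v ⌋ + (multiplicity v ys + multiplicity v zs)
    ≡⟨ cong (bit ⌊ x ≟ v ⌋ +_) (countᵇ-++ _ ys zs) ⟨
  multiplicity v (x ∷ ys ++ zs)
    ∎
  where open ≡-Reasoning

newCount+valueCount : ∀ n {k} seen (xs : Vec ℕ k) → VAll (_< suc n) xs →
  newCount seen xs + valueCount n seen ≡ valueCount n (toList xs ++ seen)
newCount+valueCount n seen [] [] = refl
newCount+valueCount n seen (x ∷ xs) (x<1+n ∷ bounded) = begin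
  new + newCount (x ∷ seen) xs + valueCount n seen
    ≡⟨ xy∙z≈y∙xz new _ _ ⟩
  newCount (x ∷ seen) xs + (new + valueCount n seen)
    ≡⟨ cong (newCount (x ∷ seen) xs +_) (+-comm new _) ⟩
  newCount (x ∷ seen) xs + (valueCount n seen + new)
    ≡⟨ cong (newCount (x ∷ seen) xs +_) (valueCount-∷ n seen x<1+n) ⟨
  newCount (x ∷ seen) xs + valueCount n (x ∷ seen)
    ≡⟨ newCount+valueCount n (x ∷ seen) xs bounded ⟩
  valueCount n (toList xs ++ x ∷ seen)
    ≡⟨ countᵇ-cong _ _ (upTo (suc n)) (λ {v} _ →
         cong (λ m → ⌊ 0 <? m ⌋) (multiplicity-++-∷ v (toList xs) x seen)) ⟩
  valueCount n (x ∷ toList xs ++ seen)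
    ∎
  where
  open ≡-Reasoning
  new = bit ⌊ multiplicity x seen ≟ 0 ⌋

luckyCount≡numRanks : ∀ {n} (b : Vec ℕ n) → InRange b →
  luckyCount (toPreference [] b) (toOutcome [] b) ≡ numRanks b
luckyCount≡numRanks {n} b ir = begin
  luckyCount (toPreference [] b) (toOutcome [] b)
    ≡⟨ luckyCount-toPreference [] b ⟩
  newCount [] b
    ≡⟨ +-identityʳ _ ⟨
  newCount [] b + 0
    ≡⟨ cong (newCount [] b +_) (countᵇ≡0 _ (upTo (suc n)) λ _ → refl) ⟨
  newCount [] b + valueCount n []
    ≡⟨ newCount+valueCount n [] b (VecAll.map (s≤s ∘′ proj₂) ir) ⟩
  valueCount n (toList b ++ [])
    ≡⟨ cong (valueCount n) (++-identityʳ (toList b)) ⟩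
  valueCount n (toList b)
    ≡⟨ countᵇ-cong _ _ (upTo (suc n)) (λ {v} _ → cong (λ m → ⌊ 0 <? m ⌋) (occ≡multiplicity v b)) ⟨
  countᵇ (λ v → ⌊ 0 <? occ v b ⌋) (upTo (suc n))
    ≡⟨ length-filter≡countᵇ (λ v → 0 <? occ v b) (upTo (suc n)) ⟨
  numRanks b
    ∎
  where open ≡-Reasoning

toPreference-≥1 : ∀ {k} seen {xs : Vec ℕ k} → VAll (1 ≤_) xs → VAll (1 ≤_) (toPreference seen xs)
toPreference-≥1 seen [] = []
toPreference-≥1 seen {x ∷ _} (1≤x ∷ pos) = ≤-trans 1≤x (m≤m+n x _) ∷ toPreference-≥1 (x ∷ seen) pos

unitRun-≤n : ∀ {n occupiedSpots k} {as ps : Vec ℕ k} → UnitRun n occupiedSpots as ps → VAll (_≤ n) as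
unitRun-≤n [] = []
unitRun-≤n (lucky _ a≤n run) = a≤n ∷ unitRun-≤n run
unitRun-≤n (unlucky _ _ sa≤n run) = <⇒≤ sa≤n ∷ unitRun-≤n run

inRange-irrelevant : ∀ {n} {b : Vec ℕ n} (p q : InRange b) → p ≡ q
inRange-irrelevant = VecAll.irrelevant λ (a , b) (c , d) → cong₂ _,_ (≤-irrelevant a c) (≤-irrelevant b d)

fubini-irrelevant : ∀ {n} {b : Vec ℕ n} (p q : IsFubiniRanking b) → p ≡ q
fubini-irrelevant (r , o , t) (r′ , o′ , t′) =
  cong₂ _,_ (inRange-irrelevant r r′) (cong₂ _,_ (<-irrelevant o o′) (T-irrelevant t t′))

upf-irrelevant : ∀ {n} {a p : Vec ℕ n} (x y : IsUPFWith a p) → x ≡ y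
upf-irrelevant (r , o , t) (r′ , o′ , t′) =
  cong₂ _,_ (inRange-irrelevant r r′) (cong₂ _,_ (uip o o′) (T-irrelevant t t′))

subst-loop : ∀ {A : Set} (P : A → Set) {x y z} (e₁ : x ≡ y) (e₂ : y ≡ z) (e₃ : z ≡ x) (p : P x) →
  subst P e₃ (subst P e₂ (subst P e₁ p)) ≡ p
subst-loop P refl refl refl p = refl

module Bijection (n : ℕ) (1≤n : 1 ≤ n) (S : ℕ → Set) where

  module Encode (b : Vec ℕ n) (fubini : IsFubiniRanking b) where
    private
      rank = fubini⇒competition b fubini
      run = Encoding.rankRun n (toList b) rank (length-toList b) [] b (λ _ → refl)

    upf : IsUPFWith (toPreference [] b) (toOutcome [] b)
    upf = VecAll.zip (toPreference-≥1 [] (VecAll.map proj₁ (proj₁ fubini)) , unitRun-≤n run) ,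
          unitRun⇒parkFrom run , unitRun⇒unitInterval run

    decode-encode : decode [] (toPreference [] b) ≡ b
    decode-encode = Encoding.decode-toPreference n (toList b) rank (length-toList b) [] b (λ _ → refl)

  module Decode (a p : Vec ℕ n) (upf : IsUPFWith a p) where
    private
      run = parkFrom⇒unitRun a p (proj₁ (proj₂ upf)) (proj₂ (proj₂ upf))
      empty : Decoding.Invariant n []
      empty = record
        { blocks = record { within-block = λ () ; fills-block = λ () } ; distinct = [] ; inRange = λ () }
      decoded = Decoding.decodeRun n [] run (VecAll.map proj₁ (proj₁ upf)) empty

    b = decode [] a

    preference≡ : toPreference [] b ≡ a
    preference≡ = proj₁ decoded

    outcome≡ : toOutcome [] b ≡ p
    outcome≡ = proj₁ (proj₂ decoded)

    fubini : IsFubiniRanking b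
    fubini = competition⇒fubini b 1≤n (Decoding.decode-competition n a (proj₂ (proj₂ decoded)))

    lucky≡ranks : luckyCount a p ≡ numRanks b
    lucky≡ranks = trans (sym (cong₂ luckyCount preference≡ outcome≡)) (luckyCount≡numRanks b (proj₁ fubini))

  to : FR-T1 n S → UPF-T1 n S
  to (b , fubini , s) = toPreference [] b , toOutcome [] b , Encode.upf b fubini ,
    subst S (sym (luckyCount≡numRanks b (proj₁ fubini))) s

  from : UPF-T1 n S → FR-T1 n S
  from (a , p , upf , s) = Decode.b a p upf , Decode.fubini a p upf , subst S (Decode.lucky≡ranks a p upf) s

  private
    FR-≡ : ∀ {b b′ : Vec ℕ n} (e : b ≡ b′) {fr fr′} {s : S (numRanks b)} {s′ : S (numRanks b′)} →
      subst S (cong numRanks e) s ≡ s′ → _≡_ {A = FR-T1 n S} (b , fr , s) (b′ , fr′ , s′)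
    FR-≡ refl {fr} {fr′} refl rewrite fubini-irrelevant fr fr′ = refl

    UPF-≡ : ∀ {a a′ p p′ : Vec ℕ n} (ea : a ≡ a′) (ep : p ≡ p′) {u u′}
      {s : S (luckyCount a p)} {s′ : S (luckyCount a′ p′)} →
      subst S (cong₂ luckyCount ea ep) s ≡ s′ → _≡_ {A = UPF-T1 n S} (a , p , u , s) (a′ , p′ , u′ , s′)
    UPF-≡ refl refl {u} {u′} refl rewrite upf-irrelevant u u′ = refl

  from∘to : ∀ x → from (to x) ≡ x
  from∘to (b , fubini , s) = FR-≡ decode-encode (subst-loop S
    (sym (luckyCount≡numRanks b (proj₁ fubini))) (Decode.lucky≡ranks _ _ upf) (cong numRanks decode-encode) s)
    where open Encode b fubini

  to∘from : ∀ y → to (from y) ≡ y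
  to∘from (a , p , upf , s) = UPF-≡ preference≡ outcome≡ (subst-loop S
    lucky≡ranks (sym (luckyCount≡numRanks b (proj₁ fubini))) (cong₂ luckyCount preference≡ outcome≡) s)
    where open Decode a p upf

theorem3p5 : (n : ℕ) → 1 ≤ n → (S : ℕ → Set) → ((k : ℕ) → S k → 1 ≤ k) →
    FR-T1 n S ↔ UPF-T1 n S
theorem3p5 n 1≤n S _ = mk↔ₛ′ to from to∘from from∘to
  where open Bijection n 1≤n S
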